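{- Let $D$ be a multidigraph that does not contain any cycle-piercing edge. Then the tree conflict hypergraph $\mathcal{H}^{\mathbf{t}}_D$ is W-chordal. As a result, the directed tree complex $\mathrm{DT}(D)$ is shellable.
   Context: A multidigraph $D$ consists of finite sets $V(D)$, $E(D)$ and maps $s,t:E(D)\to V(D)$ (source, target). Edges $e\ne f$ are parallel if $s(e)=s(f)$ and $t(e)=t(f)$. For $\sigma\subseteq E(D)$, $D[\sigma]$ is the multidigraph with edge set $\sigma$ and vertex set the endpoints of edges of $\sigma$. A directed cycle is a connected multidigraph without parallel edges in which every vertex has in-degree and out-degree $1$. An edge $e$ of $D$ is cycle-piercing if there is $\sigma\subseteq E(D)$ with $D[\sigma]$ a directed cycle and an edge $f\in\sigma$ with $t(e)=t(f)$ but $s(e)\ne s(f)$. A hypergraph $\mathcal{H}$ on a finite vertex set $V(\mathcal{H})$ is a family of subsets (hyperedges), none contained in another. The tree conflict hypergraph $\mathcal{H}^{\mathbf{t}}_D$ has vertex set $E(D)$ and hyperedges: all $\sigma\subseteq E(D)$ with $D[\sigma]$ a directed cycle; all pairs $\{e,f\}$ of parallel edges; all pairs $\{e,f\}$ with $s(e)\ne s(f)$ and $t(e)=t(f)$. For $v\in V(\mathcal{H})$, the deletion $\mathcal{H}\setminus v$ has vertex set $V(\mathcal{H})\setminus\{v\}$ and hyperedges those not containing $v$; the contraction $\mathcal{H}/v$ has vertex set $V(\mathcal{H})\setminus\{v\}$ and hyperedges the inclusion-minimal sets among $\{e\setminus\{v\}: e \text{ a hyperedge of } \mathcal{H}\}$.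 A minor is obtained by repeated deletions and/or contractions. A vertex $v$ is simplicial if for any two distinct hyperedges $e_1,e_2$ containing $v$ there is a hyperedge $e_3\subseteq (e_1\cup e_2)\setminus\{v\}$. $\mathcal{H}$ is W-chordal if every minor of $\mathcal{H}$ has a simplicial vertex. A directed forest is a digraph with no directed cycles in which no two distinct edges share a target; $\mathrm{DT}(D)$ is the simplicial complex on $E(D)$ whose faces are the $\sigma$ with $D[\sigma]$ a directed forest. A simplicial complex is shellable if its facets can be ordered $\sigma_1,\dots,\sigma_s$ so that for each $i\ge2$, $\langle\sigma_i\rangle\cap\langle\sigma_1,\dots,\sigma_{i-1}\rangle$ is pure of dimension $\dim\sigma_i-1$. -}

module Defs where

open import Data.Nat using (ℕ; suc; _<_)
open import Data.Fin using (Fin; toℕ; _≟_)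
open import Data.Fin.Subset
  using (Subset; _∈_; _∉_; _⊆_; _∪_; _∩_; _-_; ⁅_⁆; ⊤; ∣_∣; Nonempty)
open import Data.Vec using (tabulate)
open import Data.List using (List; length; lookup)
open import Data.List.Membership.Propositional using () renaming (_∈_ to _∈ˡ_)
open import Data.List.Relation.Unary.Unique.Propositional using (Unique)
open import Data.Product using (Σ; ∃; ∃-syntax; _×_; _,_)
open import Data.Sum using (_⊎_)
open import Relation.Nullary using (¬_; does)
open import Relation.Binary.PropositionalEquality using (_≡_; _≢_)
open import Function.Bundles using (_⇔_)

record Multidigraph : Set where
  field
    nV  : ℕ
    nE  : ℕ
    src : Fin nE → Fin nV
    tgt : Fin nE → Fin nV

module _ (D : Multidigraph) where
  open Multidigraph D

  Parallel : Fin nE → Fin nE → Set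
  Parallel e f = e ≢ f × src e ≡ src f × tgt e ≡ tgt f

  IsVertexOf : Subset nE → Fin nV → Set
  IsVertexOf σ v = ∃[ e ] (e ∈ σ × (src e ≡ v ⊎ tgt e ≡ v))

  indeg : Subset nE → Fin nV → ℕ
  indeg σ v = ∣ σ ∩ tabulate (λ e → does (tgt e ≟ v)) ∣

  outdeg : Subset nE → Fin nV → ℕ
  outdeg σ v = ∣ σ ∩ tabulate (λ e → does (src e ≟ v)) ∣

  data Reach (σ : Subset nE) (u : Fin nV) : Fin nV → Set where
    here : Reach σ u u
    fwd  : ∀ {w} e → Reach σ u w → e ∈ σ → src e ≡ w → Reach σ u (tgt e)
    bwd  : ∀ {w} e → Reach σ u w → e ∈ σ → tgt e ≡ w → Reach σ u (src e)

  Connected : Subset nE → Set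
  Connected σ = Nonempty σ ×
    (∀ u v → IsVertexOf σ u → IsVertexOf σ v → Reach σ u v)

  NoParallel : Subset nE → Set
  NoParallel σ = ∀ e f → e ∈ σ → f ∈ σ → ¬ Parallel e f

  IsDirCycle : Subset nE → Set
  IsDirCycle σ = Connected σ × NoParallel σ ×
    (∀ v → IsVertexOf σ v → indeg σ v ≡ 1 × outdeg σ v ≡ 1)

  CyclePiercing : Fin nE → Set
  CyclePiercing e = ∃[ σ ] (IsDirCycle σ ×
    ∃[ f ] (f ∈ σ × tgt e ≡ tgt f × src e ≢ src f))

  NoCyclePiercing : Set
  NoCyclePiercing = ∀ e → ¬ CyclePiercing e

  IsDirForest : Subset nE → Set
  IsDirForest σ = (∀ τ → τ ⊆ σ → ¬ IsDirCycle τ) ×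
    (∀ e f → e ∈ σ → f ∈ σ → e ≢ f → tgt e ≢ tgt f)

record Hypergraph (m : ℕ) : Set₁ where
  field
    V  : Subset m
    HE : Subset m → Set
open Hypergraph public

Minimal : ∀ {m} → (Subset m → Set) → Subset m → Set
Minimal P h = P h × (∀ h′ → P h′ → h′ ⊆ h → h′ ≡ h)

_∖ᴴ_ : ∀ {m} → Hypergraph m → Fin m → Hypergraph m
H ∖ᴴ v = record { V = V H - v ; HE = λ h → HE H h × v ∉ h }

_/ᴴ_ : ∀ {m} → Hypergraph m → Fin m → Hypergraph m
H /ᴴ v = record
  { V = V H - v
  ; HE = Minimal (λ h → ∃[ e ] (HE H e × h ≡ e - v)) }

data Minor {m} (H : Hypergraph m) : Hypergraph m → Set₁ where
  self : Minor H H
  del  : ∀ {H′} v → Minor H H′ → v ∈ V H′ → Minor H (H′ ∖ᴴ v)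
  con  : ∀ {H′} v → Minor H H′ → v ∈ V H′ → Minor H (H′ /ᴴ v)

Simplicial : ∀ {m} → Hypergraph m → Fin m → Set
Simplicial H v = ∀ e₁ e₂ → HE H e₁ → HE H e₂ → e₁ ≢ e₂ → v ∈ e₁ → v ∈ e₂ →
  ∃[ e₃ ] (HE H e₃ × e₃ ⊆ (e₁ ∪ e₂) - v)

WChordal : ∀ {m} → Hypergraph m → Set₁
WChordal H = ∀ H′ → Minor H H′ → Nonempty (V H′) →
  ∃[ v ] (v ∈ V H′ × Simplicial H′ v)

TreeConflictFamily : (D : Multidigraph) → Subset (Multidigraph.nE D) → Set
TreeConflictFamily D σ =
  IsDirCycle D σ
  ⊎ (∃[ e ] ∃[ f ] (Parallel D e f × σ ≡ ⁅ e ⁆ ∪ ⁅ f ⁆))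
  ⊎ (∃[ e ] ∃[ f ] (src e ≢ src f × tgt e ≡ tgt f × σ ≡ ⁅ e ⁆ ∪ ⁅ f ⁆))
  where open Multidigraph D

TreeConflict : (D : Multidigraph) → Hypergraph (Multidigraph.nE D)
TreeConflict D = record { V = ⊤ ; HE = Minimal (TreeConflictFamily D) }

IsFacet : ∀ {m} → (Subset m → Set) → Subset m → Set
IsFacet Face σ = Face σ × (∀ τ → Face τ → σ ⊆ τ → τ ≡ σ)

-- Δ is pure of dimension d-1 where d = k (faces of size k are of dim k-1):
-- every facet of Δ has exactly k elements
PureCard : ∀ {m} → (Subset m → Set) → ℕ → Set
PureCard Face k = ∀ τ → IsFacet Face τ → ∣ τ ∣ ≡ k

Shellable : ∀ {m} → (Subset m → Set) → Set
Shellable {m} Face = Σ (List (Subset m)) λ fs →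
  Unique fs × (∀ σ → (σ ∈ˡ fs) ⇔ IsFacet Face σ) ×
  (∀ (i : Fin (length fs)) → 0 < toℕ i →
     -- ⟨σ_i⟩ ∩ ⟨σ_1,…,σ_{i-1}⟩ is pure of dimension dim σ_i - 1
     ∃[ k ] (suc k ≡ ∣ lookup fs i ∣ ×
       PureCard (λ τ → τ ⊆ lookup fs i ×
                       ∃[ j ] (toℕ j < toℕ i × τ ⊆ lookup fs j)) k))

DT : (D : Multidigraph) → Subset (Multidigraph.nE D) → Set
DT D σ = IsDirForest D σ

{-# OPTIONS --safe #-}

-- Without cycle-piercing edges every edge v is a simplicial vertex of the tree conflict
-- hypergraph: two conflicts through v always combine into a conflict avoiding v.  Two
-- same-target pairs {v,x}, {v,y} give the pair {x,y}; for a pair {v,x} and a cycle through v,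
-- x is forced to be parallel to v and may replace it in the cycle; two distinct minimal cycles
-- through v must contain a parallel pair across them, since otherwise the backward walk along
-- one of them from v never leaves the other.  Simpliciality of every vertex survives deletion
-- and contraction, which gives W-chordality.  It also makes the independence complex, which is
-- DT(D), shellable in lexicographic order: if a facet A precedes B and x is the first element
-- of A outside B, then B ∪ {x} contains a unique hyperedge C through x, and exchanging x for
-- some y ∈ C outside A yields a facet preceding B and containing B - y.

module Submission where

open import Data.Empty using (⊥-elim)
open import Data.Fin using (Fin; toℕ; _≟_) renaming (zero to fzero; suc to fsuc; _<_ to _<ᶠ_)
open import Data.Fin.Properties using (any?; all?; <-cmp; pigeonhole)
open import Data.Fin.Subset
open import Data.Fin.Subset.Properties
open import Data.Fin.Subset.Induction using (Acc; acc; ⊂-wellFounded; ⊃-wellFounded)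
open import Data.Nat using (ℕ; zero; suc; _+_; z≤n; s≤s) renaming (_<_ to _<ℕ_)
import Data.Nat as ℕ
open import Data.Product using (Σ; ∃; ∃-syntax; ∃₂; _×_; _,_; proj₁; proj₂)
open import Data.Sum using (_⊎_; inj₁; inj₂; [_,_])
import Data.Sum as Sum
open import Data.List using (List; []; _∷_; _++_; map; filter; length; lookup)
open import Data.List.Membership.Propositional using () renaming (_∈_ to _∈ˡ_)
open import Data.List.Membership.Propositional.Properties using (∈-map⁺; ∈-++⁺ˡ; ∈-++⁺ʳ; ∈-filter⁺; ∈-filter⁻; ∈-lookup)
import Data.List.Relation.Unary.All as All
import Data.List.Relation.Unary.All.Properties as All
open import Data.List.Relation.Unary.AllPairs as AllPairs using (AllPairs; []; _∷_)
import Data.List.Relation.Unary.AllPairs.Properties as AllPairs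
open import Data.List.Relation.Unary.Any using (here; index)
open import Data.List.Relation.Unary.Any.Properties using (lookup-index)
open import Data.Vec using ([]; _∷_; tabulate; here; there)
open import Data.Vec.Properties using (≡-dec; []=⇒lookup; lookup⇒[]=; lookup∘tabulate)
import Data.Bool.Properties as Bool
import Data.Nat.Properties as ℕₚ
open import Function.Bundles using (_⇔_; mk⇔; Equivalence)
import Function.Properties.Equivalence as ⇔
open import Relation.Nullary using (¬_; Dec; yes; no; does)
open import Relation.Nullary.Decidable using (decidable-stable; dec-true; _×-dec_; _⊎-dec_; _→-dec_; ¬?)
open import Relation.Unary using (Decidable)
open import Relation.Binary.Definitions using (tri<; tri≈; tri>)
open import Relation.Binary.PropositionalEquality using (_≡_; _≢_; refl; sym; trans; cong; subst; module ≡-Reasoning)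
open import Defs

private variable
  n : ℕ
  p q : Subset n
  x y : Fin n

infix 4 _≟ˢ_
_≟ˢ_ : (p q : Subset n) → Dec (p ≡ q)
_≟ˢ_ = ≡-dec Bool._≟_

allSubset? : {P : Subset n → Set} → Decidable P → Dec (∀ p → P p)
allSubset? P? with anySubset? (λ p → ¬? (P? p))
... | yes (p , ¬Pp) = no (λ ∀P → ¬Pp (∀P p))
... | no ∄¬P = yes (λ p → decidable-stable (P? p) (λ ¬Pp → ∄¬P (p , ¬Pp)))

module _ {P : Fin n → Set} (P? : Decidable P) where

  ∈-tabulate⁻ : x ∈ tabulate (λ y → does (P? y)) → P x
  ∈-tabulate⁻ {x} x∈ with P? x | trans (sym (lookup∘tabulate (λ y → does (P? y)) x)) ([]=⇒lookup x∈)
  ... | yes Px | _ = Px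
  ... | no _ | ()

  ∈-tabulate⁺ : P x → x ∈ tabulate (λ y → does (P? y))
  ∈-tabulate⁺ {x} Px = lookup⇒[]= x _ (trans (lookup∘tabulate _ x) (dec-true (P? x) Px))

x∈p─q⇒x∉q : (p q : Subset n) → x ∈ p ─ q → x ∉ q
x∈p─q⇒x∉q (_ ∷ p) (outside ∷ q) here ()
x∈p─q⇒x∉q (_ ∷ p) (_ ∷ q) (there x∈p─q) (there x∈q) = x∈p─q⇒x∉q p q x∈p─q x∈q

x∈p-y⁻ : x ∈ p - y → x ∈ p × x ≢ y
x∈p-y⁻ {p = p} {y = y} x∈p-y =
  p─q⊆p p ⁅ y ⁆ x∈p-y , λ { refl → x∈p─q⇒x∉q p ⁅ y ⁆ x∈p-y (x∈⁅x⁆ y) }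

x∈p∪⁅y⁆⁻ : x ∈ p ∪ ⁅ y ⁆ → x ∈ p ⊎ x ≡ y
x∈p∪⁅y⁆⁻ {p = p} {y = y} x∈ with x∈p∪q⁻ p ⁅ y ⁆ x∈
... | inj₁ x∈p = inj₁ x∈p
... | inj₂ x∈⁅y⁆ = inj₂ (x∈⁅y⁆⇒x≡y _ x∈⁅y⁆)

x∈p⇒x∈p∪⁅y⁆ : x ∈ p → x ∈ p ∪ ⁅ y ⁆
x∈p⇒x∈p∪⁅y⁆ x∈p = x∈p∪q⁺ (inj₁ x∈p)

x∈p∪⁅y⁆∧x≢y⇒x∈p : x ∈ p ∪ ⁅ y ⁆ → x ≢ y → x ∈ p
x∈p∪⁅y⁆∧x≢y⇒x∈p x∈ x≢y = [ (λ x∈p → x∈p) , (λ x≡y → ⊥-elim (x≢y x≡y)) ] (x∈p∪⁅y⁆⁻ x∈)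

y∈p∪⁅y⁆ : y ∈ p ∪ ⁅ y ⁆
y∈p∪⁅y⁆ {y = y} = x∈p∪q⁺ (inj₂ (x∈⁅x⁆ y))

x∈⁅y⁆∪⁅z⁆⁻ : ∀ {z} → x ∈ ⁅ y ⁆ ∪ ⁅ z ⁆ → x ≡ y ⊎ x ≡ z
x∈⁅y⁆∪⁅z⁆⁻ {y = y} x∈ with x∈p∪⁅y⁆⁻ {p = ⁅ y ⁆} x∈
... | inj₁ x∈⁅y⁆ = inj₁ (x∈⁅y⁆⇒x≡y _ x∈⁅y⁆)
... | inj₂ x≡z = inj₂ x≡z

⁅x⁆∪⁅y⁆⊆p : x ∈ p → y ∈ p → ⁅ x ⁆ ∪ ⁅ y ⁆ ⊆ p
⁅x⁆∪⁅y⁆⊆p x∈p y∈p z∈ = [ (λ { refl → x∈p }) , (λ { refl → y∈p }) ] (x∈⁅y⁆∪⁅z⁆⁻ z∈)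

⊈⇒∃∈∉ : ¬ p ⊆ q → ∃[ x ] (x ∈ p × x ∉ q)
⊈⇒∃∈∉ {p = p} {q} p⊈q with any? (λ x → (x ∈? p) ×-dec ¬? (x ∈? q))
... | yes witness = witness
... | no ∄ = ⊥-elim (p⊈q λ {x} x∈p → decidable-stable (x ∈? q) (λ x∉q → ∄ (x , x∈p , x∉q)))

⊆∧≢⇒⊂ : p ⊆ q → p ≢ q → p ⊂ q
⊆∧≢⇒⊂ {p = p} {q} p⊆q p≢q with q ⊆? p
... | yes q⊆p = ⊥-elim (p≢q (⊆-antisym p⊆q q⊆p))
... | no q⊈p = p⊆q , ⊈⇒∃∈∉ q⊈p

∣p∣≡suc∣p-x∣ : x ∈ p → ∣ p ∣ ≡ suc ∣ p - x ∣
∣p∣≡suc∣p-x∣ {x = fzero} {p = inside ∷ p} here = cong suc (cong ∣_∣ (sym (p─⊥≡p p)))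
∣p∣≡suc∣p-x∣ {x = fsuc x} {p = inside ∷ p} (there x∈p) = cong suc (∣p∣≡suc∣p-x∣ x∈p)
∣p∣≡suc∣p-x∣ {x = fsuc x} {p = outside ∷ p} (there x∈p) = ∣p∣≡suc∣p-x∣ x∈p

∣p∪⁅x⁆∣≡suc∣p∣ : x ∉ p → ∣ p ∪ ⁅ x ⁆ ∣ ≡ suc ∣ p ∣
∣p∪⁅x⁆∣≡suc∣p∣ {x = fzero} {p = inside ∷ p} x∉p = ⊥-elim (x∉p here)
∣p∪⁅x⁆∣≡suc∣p∣ {x = fzero} {p = outside ∷ p} x∉p = cong suc (cong ∣_∣ (∪-identityʳ p))
∣p∪⁅x⁆∣≡suc∣p∣ {x = fsuc x} {p = inside ∷ p} x∉p = cong suc (∣p∪⁅x⁆∣≡suc∣p∣ (λ x∈p → x∉p (there x∈p)))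
∣p∪⁅x⁆∣≡suc∣p∣ {x = fsuc x} {p = outside ∷ p} x∉p = ∣p∪⁅x⁆∣≡suc∣p∣ (λ x∈p → x∉p (there x∈p))

∣p-x∪⁅y⁆∣≡∣p∣ : x ∈ p → y ∉ p → ∣ (p - x) ∪ ⁅ y ⁆ ∣ ≡ ∣ p ∣
∣p-x∪⁅y⁆∣≡∣p∣ {x = x} {p = p} x∈p y∉p =
  trans (∣p∪⁅x⁆∣≡suc∣p∣ {p = p - x} (λ y∈p-x → y∉p (proj₁ (x∈p-y⁻ y∈p-x)))) (sym (∣p∣≡suc∣p-x∣ x∈p))

∣[p-x∪⁅y⁆]∩r∣≡∣p∩r∣ : ∀ {r} → x ∈ p → y ∉ p → (x ∈ r → y ∈ r) → (y ∈ r → x ∈ r) →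
  ∣ ((p - x) ∪ ⁅ y ⁆) ∩ r ∣ ≡ ∣ p ∩ r ∣
∣[p-x∪⁅y⁆]∩r∣≡∣p∩r∣ {x = x} {p = p} {y} {r} x∈p y∉p x∈r⇒y∈r y∈r⇒x∈r with y ∈? r
... | yes y∈r = trans (cong ∣_∣ (⊆-antisym forth back))
  (∣p-x∪⁅y⁆∣≡∣p∣ (x∈p∩q⁺ (x∈p , y∈r⇒x∈r y∈r)) (λ y∈p∩r → y∉p (proj₁ (x∈p∩q⁻ p r y∈p∩r))))
  where
  forth : ((p - x) ∪ ⁅ y ⁆) ∩ r ⊆ ((p ∩ r) - x) ∪ ⁅ y ⁆
  forth z∈ with x∈p∩q⁻ _ r z∈
  ... | z∈′ , z∈r with x∈p∪⁅y⁆⁻ z∈′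
  ...   | inj₁ z∈p-x = let z∈p , z≢x = x∈p-y⁻ z∈p-x in
                       x∈p⇒x∈p∪⁅y⁆ (x∈p∧x≢y⇒x∈p-y (x∈p∩q⁺ (z∈p , z∈r)) z≢x)
  ...   | inj₂ refl = y∈p∪⁅y⁆
  back : ((p ∩ r) - x) ∪ ⁅ y ⁆ ⊆ ((p - x) ∪ ⁅ y ⁆) ∩ r
  back z∈ with x∈p∪⁅y⁆⁻ z∈
  ... | inj₁ z∈p∩r-x = let z∈p∩r , z≢x = x∈p-y⁻ z∈p∩r-x ; z∈p , z∈r = x∈p∩q⁻ p r z∈p∩r in
                       x∈p∩q⁺ (x∈p⇒x∈p∪⁅y⁆ (x∈p∧x≢y⇒x∈p-y z∈p z≢x) , z∈r)
  ... | inj₂ refl = x∈p∩q⁺ (y∈p∪⁅y⁆ , y∈r)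
... | no y∉r = cong ∣_∣ (⊆-antisym forth back)
  where
  forth : ((p - x) ∪ ⁅ y ⁆) ∩ r ⊆ p ∩ r
  forth z∈ with x∈p∩q⁻ _ r z∈
  ... | z∈′ , z∈r with x∈p∪⁅y⁆⁻ z∈′
  ...   | inj₁ z∈p-x = x∈p∩q⁺ (proj₁ (x∈p-y⁻ z∈p-x) , z∈r)
  ...   | inj₂ refl = ⊥-elim (y∉r z∈r)
  back : p ∩ r ⊆ ((p - x) ∪ ⁅ y ⁆) ∩ r
  back z∈ with x∈p∩q⁻ p r z∈
  ... | z∈p , z∈r = x∈p∩q⁺ (x∈p⇒x∈p∪⁅y⁆ (x∈p∧x≢y⇒x∈p-y z∈p λ { refl → y∉r (x∈r⇒y∈r z∈r) }) , z∈r)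

∣p∣≡suc⇒nonempty : ∀ {k} → ∣ p ∣ ≡ suc k → Nonempty p
∣p∣≡suc⇒nonempty {n} {p} ∣p∣≡suc with nonempty? p
... | yes nonempty = nonempty
... | no empty with trans (sym ∣p∣≡suc) (trans (cong ∣_∣ (Empty-unique empty)) (∣⊥∣≡0 n))
...   | ()

∣p∣≡1⇒x≡y : ∣ p ∣ ≡ 1 → x ∈ p → y ∈ p → x ≡ y
∣p∣≡1⇒x≡y {x = x} {y = y} ∣p∣≡1 x∈p y∈p with y ≟ x
... | yes y≡x = sym y≡x
... | no y≢x with trans (ℕₚ.suc-injective (trans (sym ∣p∣≡1) (∣p∣≡suc∣p-x∣ x∈p)))
                     (∣p∣≡suc∣p-x∣ (x∈p∧x≢y⇒x∈p-y y∈p y≢x))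
...   | ()

module _ {P : Subset n → Set} (P? : Decidable P) where

  minimal? : Decidable (Minimal P)
  minimal? p = P? p ×-dec allSubset? (λ q → P? q →-dec (q ⊆? p →-dec q ≟ˢ p))

  minimal-⊆ : P p → ∃[ q ] (Minimal P q × q ⊆ p)
  minimal-⊆ = go (⊂-wellFounded _)
    where
    go : Acc _⊂_ p → P p → ∃[ q ] (Minimal P q × q ⊆ p)
    go {p} (acc smaller) Pp with anySubset? (λ q → P? q ×-dec q ⊆? p ×-dec ¬? (q ≟ˢ p))
    ... | yes (q , Pq , q⊆p , q≢p) =
      let r , r-min , r⊆q = go (smaller (⊆∧≢⇒⊂ q⊆p q≢p)) Pq in r , r-min , ⊆-trans r⊆q q⊆p
    ... | no ∄ = p , (Pp , λ q Pq q⊆p → decidable-stable (q ≟ˢ p) λ q≢p → ∄ (q , Pq , q⊆p , q≢p)) , ⊆-refl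

  maximal-⊇ : P p → ∃[ q ] (IsFacet P q × p ⊆ q)
  maximal-⊇ = go (⊃-wellFounded _)
    where
    go : Acc _⊃_ p → P p → ∃[ q ] (IsFacet P q × p ⊆ q)
    go {p} (acc larger) Pp with anySubset? (λ q → P? q ×-dec p ⊆? q ×-dec ¬? (q ≟ˢ p))
    ... | yes (q , Pq , p⊆q , q≢p) =
      let r , r-max , q⊆r = go (larger (⊆∧≢⇒⊂ p⊆q (λ p≡q → q≢p (sym p≡q)))) Pq in r , r-max , ⊆-trans p⊆q q⊆r
    ... | no ∄ = p , (Pp , λ q Pq p⊆q → decidable-stable (q ≟ˢ p) λ q≢p → ∄ (q , Pq , p⊆q , q≢p)) , ⊆-refl

private variable
  m : ℕ
  H : Hypergraph m

AllSimplicial : Hypergraph m → Set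
AllSimplicial H = ∀ v → Simplicial H v

∖ᴴ-decidable : ∀ w → Decidable (HE H) → Decidable (HE (H ∖ᴴ w))
∖ᴴ-decidable w HE? h = HE? h ×-dec ¬? (w ∈? h)

trace? : ∀ w → Decidable (HE H) → Decidable (λ h → ∃[ e ] (HE H e × h ≡ e - w))
trace? w HE? h = anySubset? (λ e → HE? e ×-dec h ≟ˢ e - w)

/ᴴ-decidable : ∀ w → Decidable (HE H) → Decidable (HE (H /ᴴ w))
/ᴴ-decidable {H = H} w HE? = minimal? (trace? {H = H} w HE?)

∖ᴴ-allSimplicial : ∀ w → AllSimplicial H → AllSimplicial (H ∖ᴴ w)
∖ᴴ-allSimplicial w simplicial v e₁ e₂ (he₁ , w∉e₁) (he₂ , w∉e₂) e₁≢e₂ v∈e₁ v∈e₂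
  with simplicial v e₁ e₂ he₁ he₂ e₁≢e₂ v∈e₁ v∈e₂
... | e₃ , he₃ , e₃⊆ = e₃ , (he₃ , λ w∈e₃ → [ w∉e₁ , w∉e₂ ] (x∈p∪q⁻ e₁ e₂ (proj₁ (x∈p-y⁻ (e₃⊆ w∈e₃))))) , e₃⊆

/ᴴ-allSimplicial : ∀ w → Decidable (HE H) → AllSimplicial H → AllSimplicial (H /ᴴ w)
/ᴴ-allSimplicial {H = H} w HE? simplicial v _ _ ((c₁ , hc₁ , refl) , _) ((c₂ , hc₂ , refl) , _) c₁-w≢c₂-w v∈ v∈′
  with simplicial v c₁ c₂ hc₁ hc₂ (λ { refl → c₁-w≢c₂-w refl }) (proj₁ (x∈p-y⁻ v∈)) (proj₁ (x∈p-y⁻ v∈′))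
... | c₃ , hc₃ , c₃⊆ with minimal-⊆ (trace? {H = H} w HE?) (c₃ , hc₃ , refl)
... | e , e-min , e⊆c₃-w = e , e-min , λ {x} x∈e →
  let x∈c₃ , x≢w = x∈p-y⁻ (e⊆c₃-w x∈e)
      x∈c₁∪c₂ , x≢v = x∈p-y⁻ (c₃⊆ x∈c₃)
      keep : ∀ {c} → x ∈ c → x ∈ c - w
      keep x∈c = x∈p∧x≢y⇒x∈p-y x∈c x≢w
  in x∈p∧x≢y⇒x∈p-y (x∈p∪q⁺ (Sum.map keep keep (x∈p∪q⁻ c₁ c₂ x∈c₁∪c₂))) x≢v

minor-allSimplicial : ∀ {H′} → Decidable (HE H) → AllSimplicial H → Minor H H′ →
  Decidable (HE H′) × AllSimplicial H′
minor-allSimplicial HE? simplicial self = HE? , simplicial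
minor-allSimplicial HE? simplicial (del {H′} w minor _) =
  let HE′? , simplicial′ = minor-allSimplicial HE? simplicial minor
  in ∖ᴴ-decidable {H = H′} w HE′? , ∖ᴴ-allSimplicial {H = H′} w simplicial′
minor-allSimplicial HE? simplicial (con {H′} w minor _) =
  let HE′? , simplicial′ = minor-allSimplicial HE? simplicial minor
  in /ᴴ-decidable {H = H′} w HE′? , /ᴴ-allSimplicial {H = H′} w HE′? simplicial′

allSimplicial⇒wChordal : Decidable (HE H) → AllSimplicial H → WChordal H
allSimplicial⇒wChordal HE? simplicial H′ minor (v , v∈V) =
  v , v∈V , proj₂ (minor-allSimplicial HE? simplicial minor) v

infix 4 _≺_
data _≺_ : Subset n → Subset n → Set where
  here  : (inside ∷ p) ≺ (outside ∷ q)
  there : ∀ {s} → p ≺ q → (s ∷ p) ≺ (s ∷ q)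

≺-irrefl : ¬ p ≺ p
≺-irrefl (there p≺p) = ≺-irrefl p≺p

≺-asym : p ≺ q → ¬ q ≺ p
≺-asym (there p≺q) (there q≺p) = ≺-asym p≺q q≺p

≺⇒first-difference : p ≺ q → ∃[ x ] (x ∈ p × x ∉ q × (∀ {y} → y ∈ q → y ∉ p → x <ᶠ y))
≺⇒first-difference here = fzero , here , (λ ()) , λ { {fzero} () ; {fsuc y} _ _ → s≤s z≤n }
≺⇒first-difference (there {s = s} p≺q) with ≺⇒first-difference p≺q
... | x , x∈p , x∉q , x-first = fsuc x , there x∈p , (λ { (there x∈q) → x∉q x∈q }) , earlier
  where
  earlier : ∀ {y} → y ∈ s ∷ _ → y ∉ s ∷ _ → fsuc x <ᶠ y
  earlier {fzero} here y∉ = ⊥-elim (y∉ here)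
  earlier {fsuc y} (there y∈q) y∉p = s≤s (x-first y∈q (λ y∈p → y∉p (there y∈p)))

first-difference⇒≺ : x ∈ p → x ∉ q → q - y ⊆ p → x <ᶠ y → p ≺ q
first-difference⇒≺ {x = fzero} {p = inside ∷ _} {q = inside ∷ _} here x∉q _ _ = ⊥-elim (x∉q here)
first-difference⇒≺ {x = fzero} {p = inside ∷ _} {q = outside ∷ _} here _ _ _ = here
first-difference⇒≺ {x = fsuc x} {p = s ∷ p} {q = inside ∷ q} {y = fsuc y} (there x∈p) x∉q q-y⊆p (s≤s x<y)
  with q-y⊆p here
... | here = there (first-difference⇒≺ x∈p (λ x∈q → x∉q (there x∈q)) (λ z∈ → drop-there (q-y⊆p (there z∈))) x<y)
first-difference⇒≺ {x = fsuc x} {p = inside ∷ p} {q = outside ∷ q} (there _) _ _ _ = here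
first-difference⇒≺ {x = fsuc x} {p = outside ∷ p} {q = outside ∷ q} {y = fsuc y} (there x∈p) x∉q q-y⊆p (s≤s x<y) =
  there (first-difference⇒≺ x∈p (λ x∈q → x∉q (there x∈q)) (λ z∈ → drop-there (q-y⊆p (there z∈))) x<y)

subsets : ∀ n → List (Subset n)
subsets zero = [] ∷ []
subsets (suc n) = map (inside ∷_) (subsets n) ++ map (outside ∷_) (subsets n)

∈-subsets : ∀ (p : Subset n) → p ∈ˡ subsets n
∈-subsets [] = here refl
∈-subsets {suc n} (inside ∷ p) = ∈-++⁺ˡ (∈-map⁺ (inside ∷_) (∈-subsets p))
∈-subsets {suc n} (outside ∷ p) = ∈-++⁺ʳ (map (inside ∷_) (subsets n)) (∈-map⁺ (outside ∷_) (∈-subsets p))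

subsets-sorted : ∀ n → AllPairs _≺_ (subsets n)
subsets-sorted zero = All.[] ∷ []
subsets-sorted (suc n) = AllPairs.++⁺
  (AllPairs.map⁺ (AllPairs.map there (subsets-sorted n)))
  (AllPairs.map⁺ (AllPairs.map there (subsets-sorted n)))
  (All.map⁺ (All.universal (λ _ → All.map⁺ (All.universal (λ _ → here) (subsets n))) (subsets n)))

AllPairs-lookup : ∀ {A : Set} {R : A → A → Set} {xs : List A} → AllPairs R xs →
  ∀ {i j} → i <ᶠ j → R (lookup xs i) (lookup xs j)
AllPairs-lookup (Rx ∷ _) {fzero} {fsuc j} _ = All.lookup Rx (∈-lookup j)
AllPairs-lookup (_ ∷ Rxs) {fsuc i} {fsuc j} (s≤s i<j) = AllPairs-lookup Rxs i<j

0<i⇒∃j<i : (i : Fin n) → 0 <ℕ toℕ i → Σ (Fin n) (_<ᶠ i)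
0<i⇒∃j<i (fsuc _) _ = fzero , s≤s z≤n

Exchange : (Subset m → Set) → Set
Exchange Face = ∀ {A B} → IsFacet Face A → IsFacet Face B → A ≺ B →
  ∃[ y ] (y ∈ B × y ∉ A × ∃[ F ] (IsFacet Face F × F ≺ B × B - y ⊆ F))

module LexShelling {Face : Subset m → Set} (σs : List (Subset m)) (sorted : AllPairs _≺_ σs)
  (∈σs⇔facet : ∀ σ → σ ∈ˡ σs ⇔ IsFacet Face σ) (exchange : Exchange Face) where

  facet-at : ∀ i → IsFacet Face (lookup σs i)
  facet-at i = Equivalence.to (∈σs⇔facet (lookup σs i)) (∈-lookup i)

  ≺⇒index-< : ∀ {i j} → lookup σs j ≺ lookup σs i → j <ᶠ i
  ≺⇒index-< {i} {j} σⱼ≺σᵢ with <-cmp j i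
  ... | tri< j<i _ _ = j<i
  ... | tri≈ _ refl _ = ⊥-elim (≺-irrefl σⱼ≺σᵢ)
  ... | tri> _ _ i<j = ⊥-elim (≺-asym σⱼ≺σᵢ (AllPairs-lookup sorted i<j))

  EarlierFace : Fin (length σs) → Subset m → Set
  EarlierFace i τ = τ ⊆ lookup σs i × ∃[ j ] (toℕ j <ℕ toℕ i × τ ⊆ lookup σs j)

  earlier-facet-codim-one : ∀ {i j} → j <ᶠ i →
    ∃[ y ] (y ∈ lookup σs i × y ∉ lookup σs j × EarlierFace i (lookup σs i - y))
  earlier-facet-codim-one {i} {j} j<i with exchange (facet-at j) (facet-at i) (AllPairs-lookup sorted j<i)
  ... | y , y∈σᵢ , y∉σⱼ , F , F-facet , F≺σᵢ , σᵢ-y⊆F =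
    y , y∈σᵢ , y∉σⱼ , p─q⊆p (lookup σs i) ⁅ y ⁆ , index F∈ ,
    ≺⇒index-< (subst (_≺ lookup σs i) F≡ F≺σᵢ) , subst (lookup σs i - y ⊆_) F≡ σᵢ-y⊆F
    where
    F∈ : F ∈ˡ σs
    F∈ = Equivalence.from (∈σs⇔facet F) F-facet
    F≡ : F ≡ lookup σs (index F∈)
    F≡ = lookup-index F∈

  earlier-faces-pure : ∀ i → 0 <ℕ toℕ i →
    ∃[ k ] (suc k ≡ ∣ lookup σs i ∣ × PureCard (EarlierFace i) k)
  earlier-faces-pure i 0<i with earlier-facet-codim-one (proj₂ (0<i⇒∃j<i i 0<i))
  ... | y₀ , y₀∈σᵢ , _ = ∣ lookup σs i - y₀ ∣ , sym (∣p∣≡suc∣p-x∣ y₀∈σᵢ) , pure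
    where
    pure : PureCard (EarlierFace i) ∣ lookup σs i - y₀ ∣
    pure τ ((τ⊆σᵢ , j , j<i , τ⊆σⱼ) , τ-max) with earlier-facet-codim-one j<i
    ... | y , y∈σᵢ , y∉σⱼ , σᵢ-y-earlier = begin
      ∣ τ ∣                  ≡⟨ cong ∣_∣ (sym (τ-max (lookup σs i - y) σᵢ-y-earlier τ⊆σᵢ-y)) ⟩
      ∣ lookup σs i - y ∣   ≡⟨ ℕₚ.suc-injective (trans (sym (∣p∣≡suc∣p-x∣ y∈σᵢ)) (∣p∣≡suc∣p-x∣ y₀∈σᵢ)) ⟩
      ∣ lookup σs i - y₀ ∣ ∎
      where
      open ≡-Reasoning
      τ⊆σᵢ-y : τ ⊆ lookup σs i - y
      τ⊆σᵢ-y z∈τ = x∈p∧x≢y⇒x∈p-y (τ⊆σᵢ z∈τ) λ { refl → y∉σⱼ (τ⊆σⱼ z∈τ) }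

  shellable : Shellable Face
  shellable = σs , AllPairs.map (λ σ≺τ σ≡τ → ≺-irrefl (subst (_ ≺_) (sym σ≡τ) σ≺τ)) sorted , ∈σs⇔facet ,
    earlier-faces-pure

Independent : Hypergraph m → Subset m → Set
Independent H σ = ∀ h → HE H h → ¬ h ⊆ σ

module IndependenceComplex {H : Hypergraph m} (HE? : Decidable (HE H)) (simplicial : AllSimplicial H) where

  independent? : Decidable (Independent H)
  independent? σ = allSubset? (λ h → HE? h →-dec ¬? (h ⊆? σ))

  facet? : Decidable (IsFacet (Independent H))
  facet? σ = independent? σ ×-dec allSubset? (λ τ → independent? τ →-dec (σ ⊆? τ →-dec τ ≟ˢ σ))

  facet∪⁅x⁆-dependent : ∀ {B} → IsFacet (Independent H) B → x ∉ B →
    ∃[ C ] (HE H C × C ⊆ B ∪ ⁅ x ⁆ × x ∈ C)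
  facet∪⁅x⁆-dependent {x = x} {B} (B-indep , B-max) x∉B
    with anySubset? (λ C → HE? C ×-dec C ⊆? B ∪ ⁅ x ⁆)
  ... | no ∄ = ⊥-elim (x∉B (subst (x ∈_) (B-max (B ∪ ⁅ x ⁆) B∪⁅x⁆-indep x∈p⇒x∈p∪⁅y⁆) y∈p∪⁅y⁆))
    where
    B∪⁅x⁆-indep : Independent H (B ∪ ⁅ x ⁆)
    B∪⁅x⁆-indep C hC C⊆ = ∄ (C , hC , C⊆)
  ... | yes (C , hC , C⊆) with x ∈? C
  ...   | yes x∈C = C , hC , C⊆ , x∈C
  ...   | no x∉C = ⊥-elim (B-indep C hC λ z∈C → x∈p∪⁅y⁆∧x≢y⇒x∈p (C⊆ z∈C) λ { refl → x∉C z∈C })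

  -- Two hyperedges through x inside B ∪ {x} would, by simpliciality at x, give one inside B;
  -- so C is the only one, and removing any other y ∈ C restores independence.
  exchange-independent : ∀ {B C} → Independent H B → HE H C → C ⊆ B ∪ ⁅ x ⁆ → x ∈ C →
    y ∈ C → y ≢ x → Independent H ((B - y) ∪ ⁅ x ⁆)
  exchange-independent {x = x} {y = y} {B} {C} B-indep hC C⊆ x∈C y∈C y≢x h hh h⊆ with x ∈? h
  ... | no x∉h = B-indep h hh λ z∈h →
    proj₁ (x∈p-y⁻ (x∈p∪⁅y⁆∧x≢y⇒x∈p (h⊆ z∈h) λ { refl → x∉h z∈h }))
  ... | yes x∈h with simplicial x C h hC hh (λ { refl → y∉h (h⊆ y∈C) }) x∈C x∈h
    where
    y∉h : y ∉ (B - y) ∪ ⁅ x ⁆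
    y∉h y∈ = proj₂ (x∈p-y⁻ (x∈p∪⁅y⁆∧x≢y⇒x∈p y∈ y≢x)) refl
  ...   | e , he , e⊆ = B-indep e he λ z∈e →
    let z∈C∪h , z≢x = x∈p-y⁻ (e⊆ z∈e) in
    [ (λ z∈C → x∈p∪⁅y⁆∧x≢y⇒x∈p (C⊆ z∈C) z≢x)
    , (λ z∈h → proj₁ (x∈p-y⁻ (x∈p∪⁅y⁆∧x≢y⇒x∈p (h⊆ z∈h) z≢x)))
    ] (x∈p∪q⁻ C h z∈C∪h)

  exchange : Exchange (Independent H)
  exchange {A} {B} (A-indep , _) B-facet A≺B with ≺⇒first-difference A≺B
  ... | x , x∈A , x∉B , x-first with facet∪⁅x⁆-dependent B-facet x∉B
  ... | C , hC , C⊆ , x∈C with C ⊆? A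
  ...   | yes C⊆A = ⊥-elim (A-indep C hC C⊆A)
  ...   | no C⊈A with ⊈⇒∃∈∉ C⊈A
  ...     | y , y∈C , y∉A =
    let F , F-facet , B′⊆F = maximal-⊇ independent? (exchange-independent (proj₁ B-facet) hC C⊆ x∈C y∈C y≢x)
        B-y⊆F : B - y ⊆ F
        B-y⊆F z∈B-y = B′⊆F (x∈p⇒x∈p∪⁅y⁆ z∈B-y)
    in y , y∈B , y∉A , F , F-facet , first-difference⇒≺ (B′⊆F y∈p∪⁅y⁆) x∉B B-y⊆F (x-first y∈B y∉A) , B-y⊆F
    where
    y≢x : y ≢ x
    y≢x refl = y∉A x∈A
    y∈B : y ∈ B
    y∈B = x∈p∪⁅y⁆∧x≢y⇒x∈p (C⊆ y∈C) y≢x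

  facets : List (Subset m)
  facets = filter facet? (subsets m)

  ∈-facets : ∀ σ → σ ∈ˡ facets ⇔ IsFacet (Independent H) σ
  ∈-facets σ = mk⇔ (λ σ∈ → proj₂ (∈-filter⁻ facet? {xs = subsets m} σ∈)) (∈-filter⁺ facet? (∈-subsets σ))

  independent-shellable : Shellable (Independent H)
  independent-shellable =
    LexShelling.shellable facets (AllPairs.filter⁺ facet? (subsets-sorted m)) ∈-facets exchange

isFacet-cong : ∀ {F G : Subset m → Set} → (∀ σ → F σ ⇔ G σ) → ∀ σ → IsFacet F σ ⇔ IsFacet G σ
isFacet-cong F⇔G σ = mk⇔ (transfer F⇔G) (transfer (λ τ → ⇔.sym (F⇔G τ)))
  where
  transfer : ∀ {F G} → (∀ τ → F τ ⇔ G τ) → IsFacet F σ → IsFacet G σ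
  transfer F⇔G (Fσ , σ-max) = Equivalence.to (F⇔G σ) Fσ , λ τ Gτ σ⊆τ → σ-max τ (Equivalence.from (F⇔G τ) Gτ) σ⊆τ

shellable-cong : ∀ {F G : Subset m → Set} → (∀ σ → F σ ⇔ G σ) → Shellable F → Shellable G
shellable-cong F⇔G (σs , unique , ∈σs⇔facet , shelling) =
  σs , unique , (λ σ → ⇔.trans (∈σs⇔facet σ) (isFacet-cong F⇔G σ)) , shelling

module Reachability (D : Multidigraph) (σ : Subset (Multidigraph.nE D)) (u : Fin (Multidigraph.nV D)) where
  open Multidigraph D

  Adjacent : Subset nV → Fin nV → Set
  Adjacent R x = ∃[ e ] (e ∈ σ × (tgt e ≡ x × src e ∈ R ⊎ src e ≡ x × tgt e ∈ R))

  adjacent? : ∀ R → Decidable (Adjacent R)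
  adjacent? R x = any? λ e → e ∈? σ ×-dec ((tgt e ≟ x ×-dec src e ∈? R) ⊎-dec (src e ≟ x ×-dec tgt e ∈? R))

  within-one-step? : ∀ R → Decidable (λ x → x ∈ R ⊎ Adjacent R x)
  within-one-step? R x = x ∈? R ⊎-dec adjacent? R x

  step : Subset nV → Subset nV
  step R = tabulate (λ x → does (within-one-step? R x))

  Sound : Subset nV → Set
  Sound R = ∀ {x} → x ∈ R → Reach D σ u x

  step-sound : ∀ {R} → Sound R → Sound (step R)
  step-sound {R} sound x∈ with ∈-tabulate⁻ (within-one-step? R) x∈
  ... | inj₁ x∈R = sound x∈R
  ... | inj₂ (e , e∈σ , inj₁ (refl , src∈R)) = fwd e (sound src∈R) e∈σ refl
  ... | inj₂ (e , e∈σ , inj₂ (refl , tgt∈R)) = bwd e (sound tgt∈R) e∈σ refl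

  ⊆-step : ∀ {R} → R ⊆ step R
  ⊆-step {R} x∈R = ∈-tabulate⁺ (within-one-step? R) (inj₁ x∈R)

  sound-closure : ∀ {R} → Sound R → ∃[ R′ ] (Sound R′ × R ⊆ R′ × step R′ ⊆ R′)
  sound-closure = go (⊃-wellFounded _)
    where
    go : ∀ {R} → Acc _⊃_ R → Sound R → ∃[ R′ ] (Sound R′ × R ⊆ R′ × step R′ ⊆ R′)
    go {R} (acc larger) sound with step R ⊆? R
    ... | yes closed = R , sound , ⊆-refl , closed
    ... | no not-closed =
      let R′ , sound′ , step-R⊆R′ , closed = go (larger (⊆-step , ⊈⇒∃∈∉ not-closed)) (step-sound sound)
      in R′ , sound′ , ⊆-trans ⊆-step step-R⊆R′ , closed

  closed-complete : ∀ {R x} → step R ⊆ R → u ∈ R → Reach D σ u x → x ∈ R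
  closed-complete closed u∈R here = u∈R
  closed-complete {R} closed u∈R (fwd e r e∈σ refl) =
    closed (∈-tabulate⁺ (within-one-step? R) (inj₂ (e , e∈σ , inj₁ (refl , closed-complete closed u∈R r))))
  closed-complete {R} closed u∈R (bwd e r e∈σ refl) =
    closed (∈-tabulate⁺ (within-one-step? R) (inj₂ (e , e∈σ , inj₂ (refl , closed-complete closed u∈R r))))

  reach? : Decidable (Reach D σ u)
  reach? x with sound-closure {⁅ u ⁆} (λ u∈ → subst (Reach D σ u) (sym (x∈⁅y⁆⇒x≡y _ u∈)) here)
  ... | R , sound , ⁅u⁆⊆R , closed with x ∈? R
  ...   | yes x∈R = yes (sound x∈R)
  ...   | no x∉R = no (λ r → x∉R (closed-complete closed (⁅u⁆⊆R (x∈⁅x⁆ u)) r))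

module _ (D : Multidigraph) where
  open Multidigraph D

  isVertexOf? : ∀ σ → Decidable (IsVertexOf D σ)
  isVertexOf? σ v = any? (λ e → e ∈? σ ×-dec (src e ≟ v ⊎-dec tgt e ≟ v))

  connected? : Decidable (Connected D)
  connected? σ = nonempty? σ ×-dec
    all? (λ u → all? (λ v → isVertexOf? σ u →-dec (isVertexOf? σ v →-dec Reachability.reach? D σ u v)))

  parallel? : ∀ e f → Dec (Parallel D e f)
  parallel? e f = ¬? (e ≟ f) ×-dec src e ≟ src f ×-dec tgt e ≟ tgt f

  noParallel? : Decidable (NoParallel D)
  noParallel? σ = all? (λ e → all? (λ f → e ∈? σ →-dec (f ∈? σ →-dec ¬? (parallel? e f))))

  isDirCycle? : Decidable (IsDirCycle D)
  isDirCycle? σ = connected? σ ×-dec noParallel? σ ×-dec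
    all? (λ v → isVertexOf? σ v →-dec (indeg D σ v ℕ.≟ 1 ×-dec outdeg D σ v ℕ.≟ 1))

  treeConflictFamily? : Decidable (TreeConflictFamily D)
  treeConflictFamily? σ = isDirCycle? σ
    ⊎-dec any? (λ e → any? (λ f → parallel? e f ×-dec σ ≟ˢ ⁅ e ⁆ ∪ ⁅ f ⁆))
    ⊎-dec any? (λ e → any? (λ f → ¬? (src e ≟ src f) ×-dec tgt e ≟ tgt f ×-dec σ ≟ˢ ⁅ e ⁆ ∪ ⁅ f ⁆))

  treeConflict? : Decidable (HE (TreeConflict D))
  treeConflict? = minimal? treeConflictFamily?

  module DirCycle {c : Subset nE} (cycle : IsDirCycle D c) where

    indeg≡1 : ∀ {y} → IsVertexOf D c y → indeg D c y ≡ 1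
    indeg≡1 y∈V = proj₁ (proj₂ (proj₂ cycle) _ y∈V)

    outdeg≡1 : ∀ {y} → IsVertexOf D c y → outdeg D c y ≡ 1
    outdeg≡1 y∈V = proj₂ (proj₂ (proj₂ cycle) _ y∈V)

    in-edge : ∀ {y} → IsVertexOf D c y → ∃[ e ] (e ∈ c × tgt e ≡ y)
    in-edge {y} y∈V with ∣p∣≡suc⇒nonempty (indeg≡1 y∈V)
    ... | e , e∈ = let e∈c , e∈T = x∈p∩q⁻ c _ e∈ in e , e∈c , ∈-tabulate⁻ (λ e → tgt e ≟ y) e∈T

    in-edge-unique : ∀ {e f} → e ∈ c → f ∈ c → tgt e ≡ tgt f → e ≡ f
    in-edge-unique {e} {f} e∈c f∈c tgt≡ = ∣p∣≡1⇒x≡y (indeg≡1 (f , f∈c , inj₂ refl))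
      (x∈p∩q⁺ (e∈c , ∈-tabulate⁺ (λ e → tgt e ≟ tgt f) tgt≡))
      (x∈p∩q⁺ (f∈c , ∈-tabulate⁺ (λ e → tgt e ≟ tgt f) refl))

    out-edge-unique : ∀ {e f} → e ∈ c → f ∈ c → src e ≡ src f → e ≡ f
    out-edge-unique {e} {f} e∈c f∈c src≡ = ∣p∣≡1⇒x≡y (outdeg≡1 (f , f∈c , inj₁ refl))
      (x∈p∩q⁺ (e∈c , ∈-tabulate⁺ (λ e → src e ≟ src f) src≡))
      (x∈p∩q⁺ (f∈c , ∈-tabulate⁺ (λ e → src e ≟ src f) refl))

    predecessor : Fin nE → Fin nE
    predecessor e with any? (λ f → f ∈? c ×-dec tgt f ≟ src e)
    ... | yes (f , _) = f
    ... | no _ = e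

    predecessor-spec : ∀ {e} → e ∈ c → predecessor e ∈ c × tgt (predecessor e) ≡ src e
    predecessor-spec {e} e∈c with any? (λ f → f ∈? c ×-dec tgt f ≟ src e)
    ... | yes (_ , spec) = spec
    ... | no ∄ = ⊥-elim (∄ (in-edge (e , e∈c , inj₁ refl)))

    predecessor-injective : ∀ {e f} → e ∈ c → f ∈ c → predecessor e ≡ predecessor f → e ≡ f
    predecessor-injective e∈c f∈c eq = out-edge-unique e∈c f∈c (begin
      src _ ≡⟨ sym (proj₂ (predecessor-spec e∈c)) ⟩
      tgt (predecessor _) ≡⟨ cong tgt eq ⟩
      tgt (predecessor _) ≡⟨ proj₂ (predecessor-spec f∈c) ⟩
      src _ ∎)
      where open ≡-Reasoning

    module BackwardOrbit {v : Fin nE} (v∈c : v ∈ c) where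

      orbit : ℕ → Fin nE
      orbit zero = v
      orbit (suc k) = predecessor (orbit k)

      orbit-∈ : ∀ k → orbit k ∈ c
      orbit-∈ zero = v∈c
      orbit-∈ (suc k) = proj₁ (predecessor-spec (orbit-∈ k))

      InOrbit : Fin nE → Set
      InOrbit e = ∃[ k ] (e ≡ orbit k)

      orbit-periodic : ∃[ k ] (v ≡ orbit (suc k))
      orbit-periodic with pigeonhole (ℕₚ.n<1+n nE) (λ i → orbit (toℕ i))
      ... | i , j , i<j , orbit-i≡orbit-j with ℕₚ.m≤n⇒∃[o]m+o≡n i<j
      ...   | o , i+1+o≡j = o , cancel (toℕ i) (trans orbit-i≡orbit-j (cong orbit (sym i+1+o≡j)))
        where
        cancel : ∀ a → orbit a ≡ orbit (suc (a + o)) → v ≡ orbit (suc o)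
        cancel zero eq = eq
        cancel (suc a) eq = cancel a (predecessor-injective (orbit-∈ a) (orbit-∈ (suc (a + o))) eq)

      InOrbit-predecessor⁻ : ∀ {e} → e ∈ c → InOrbit (predecessor e) → InOrbit e
      InOrbit-predecessor⁻ e∈c (zero , eq) =
        let k , v≡ = orbit-periodic in k , predecessor-injective e∈c (orbit-∈ k) (trans eq v≡)
      InOrbit-predecessor⁻ e∈c (suc k , eq) = k , predecessor-injective e∈c (orbit-∈ k) eq

      reach⇒entered : ∀ {y} → Reach D c (tgt v) y → ∃[ e ] (InOrbit e × tgt e ≡ y)
      reach⇒entered here = v , (0 , refl) , refl
      reach⇒entered (fwd e r e∈c refl) with reach⇒entered r
      ... | o , (k , refl) , tgt-o≡src-e =
        e , InOrbit-predecessor⁻ e∈c (k , in-edge-unique (proj₁ (predecessor-spec e∈c)) (orbit-∈ k)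
              (trans (proj₂ (predecessor-spec e∈c)) (sym tgt-o≡src-e))) , refl
      reach⇒entered (bwd e r e∈c refl) with reach⇒entered r
      ... | o , (k , refl) , tgt-o≡tgt-e with in-edge-unique e∈c (orbit-∈ k) (sym tgt-o≡tgt-e)
      ...   | refl = predecessor e , (suc k , refl) , proj₂ (predecessor-spec e∈c)

      orbit-complete : ∀ {e} → e ∈ c → InOrbit e
      orbit-complete {e} e∈c
        with reach⇒entered (proj₂ (proj₁ cycle) (tgt v) (tgt e) (v , v∈c , inj₂ refl) (e , e∈c , inj₂ refl))
      ... | o , (k , refl) , tgt≡ = k , in-edge-unique e∈c (orbit-∈ k) (sym tgt≡)

  infix 4 _⊑_
  _⊑_ : Subset nE → Subset nE → Set
  σ ⊑ τ = ∀ {e} → e ∈ σ → ∃[ e′ ] (e′ ∈ τ × src e′ ≡ src e × tgt e′ ≡ tgt e)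

  isVertexOf-⊑ : ∀ {σ τ y} → σ ⊑ τ → IsVertexOf D σ y → IsVertexOf D τ y
  isVertexOf-⊑ σ⊑τ (e , e∈σ , inj₁ refl) = let e′ , e′∈τ , src≡ , _ = σ⊑τ e∈σ in e′ , e′∈τ , inj₁ src≡
  isVertexOf-⊑ σ⊑τ (e , e∈σ , inj₂ refl) = let e′ , e′∈τ , _ , tgt≡ = σ⊑τ e∈σ in e′ , e′∈τ , inj₂ tgt≡

  reach-⊑ : ∀ {σ τ a b} → σ ⊑ τ → Reach D σ a b → Reach D τ a b
  reach-⊑ σ⊑τ here = here
  reach-⊑ σ⊑τ (fwd e r e∈σ src≡) with σ⊑τ e∈σ
  ... | e′ , e′∈τ , src′≡ , tgt′≡ = subst (Reach D _ _) tgt′≡ (fwd e′ (reach-⊑ σ⊑τ r) e′∈τ (trans src′≡ src≡))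
  reach-⊑ σ⊑τ (bwd e r e∈σ tgt≡) with σ⊑τ e∈σ
  ... | e′ , e′∈τ , src′≡ , tgt′≡ = subst (Reach D _ _) src′≡ (bwd e′ (reach-⊑ σ⊑τ r) e′∈τ (trans tgt′≡ tgt≡))

  swap-parallel : ∀ {c v x} → IsDirCycle D c → v ∈ c → x ∉ c → src x ≡ src v → tgt x ≡ tgt v →
    IsDirCycle D ((c - v) ∪ ⁅ x ⁆)
  swap-parallel {c} {v} {x} ((_ , connected) , noParallel , degrees) v∈c x∉c src≡ tgt≡ =
    ((x , y∈p∪⁅y⁆) , connected′) , noParallel′ , degrees′
    where
    c′ = (c - v) ∪ ⁅ x ⁆

    c⊑c′ : c ⊑ c′
    c⊑c′ {e} e∈c with e ≟ v
    ... | yes refl = x , y∈p∪⁅y⁆ , src≡ , tgt≡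
    ... | no e≢v = e , x∈p⇒x∈p∪⁅y⁆ (x∈p∧x≢y⇒x∈p-y e∈c e≢v) , refl , refl

    c′⊑c : c′ ⊑ c
    c′⊑c {e} e∈c′ with x∈p∪⁅y⁆⁻ e∈c′
    ... | inj₁ e∈c-v = e , proj₁ (x∈p-y⁻ e∈c-v) , refl , refl
    ... | inj₂ refl = v , v∈c , sym src≡ , sym tgt≡

    connected′ : ∀ a b → IsVertexOf D c′ a → IsVertexOf D c′ b → Reach D c′ a b
    connected′ a b a∈ b∈ = reach-⊑ c⊑c′ (connected a b (isVertexOf-⊑ c′⊑c a∈) (isVertexOf-⊑ c′⊑c b∈))

    noParallel′ : NoParallel D c′
    noParallel′ e f e∈ f∈ (e≢f , src-ef , tgt-ef) with x∈p∪⁅y⁆⁻ e∈ | x∈p∪⁅y⁆⁻ f∈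
    ... | inj₁ e∈c-v | inj₁ f∈c-v =
      noParallel e f (proj₁ (x∈p-y⁻ e∈c-v)) (proj₁ (x∈p-y⁻ f∈c-v)) (e≢f , src-ef , tgt-ef)
    ... | inj₁ e∈c-v | inj₂ refl =
      noParallel e v (proj₁ (x∈p-y⁻ e∈c-v)) v∈c (proj₂ (x∈p-y⁻ e∈c-v) , trans src-ef src≡ , trans tgt-ef tgt≡)
    ... | inj₂ refl | inj₁ f∈c-v =
      noParallel v f v∈c (proj₁ (x∈p-y⁻ f∈c-v))
        ((λ v≡f → proj₂ (x∈p-y⁻ f∈c-v) (sym v≡f)) , trans (sym src≡) src-ef , trans (sym tgt≡) tgt-ef)
    ... | inj₂ refl | inj₂ refl = e≢f refl

    count-preserved : (end : Fin nE → Fin nV) → end x ≡ end v → ∀ y →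
      ∣ c′ ∩ tabulate (λ e → does (end e ≟ y)) ∣ ≡ ∣ c ∩ tabulate (λ e → does (end e ≟ y)) ∣
    count-preserved end end≡ y = ∣[p-x∪⁅y⁆]∩r∣≡∣p∩r∣ v∈c x∉c
      (λ v∈ → ∈-tabulate⁺ (λ e → end e ≟ y) (trans end≡ (∈-tabulate⁻ (λ e → end e ≟ y) v∈)))
      (λ x∈ → ∈-tabulate⁺ (λ e → end e ≟ y) (trans (sym end≡) (∈-tabulate⁻ (λ e → end e ≟ y) x∈)))

    degrees′ : ∀ y → IsVertexOf D c′ y → indeg D c′ y ≡ 1 × outdeg D c′ y ≡ 1
    degrees′ y y∈ = let indeg≡1 , outdeg≡1 = degrees y (isVertexOf-⊑ c′⊑c y∈) in
      trans (count-preserved tgt tgt≡ y) indeg≡1 , trans (count-preserved src src≡ y) outdeg≡1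

  -- Without cycle-piercing edges, an edge of c₁ entering a vertex of c₂ is in c₂ or parallel to
  -- an edge of c₂; so the backward orbit of a common edge never leaves c₂.
  cycle-⊆ : NoCyclePiercing D → ∀ {c₁ c₂ v} → IsDirCycle D c₁ → IsDirCycle D c₂ → v ∈ c₁ → v ∈ c₂ →
    (∀ e e′ → e ∈ c₁ → e′ ∈ c₂ → ¬ Parallel D e e′) → c₁ ⊆ c₂
  cycle-⊆ noPiercing {c₁} {c₂} {v} cycle₁ cycle₂ v∈c₁ v∈c₂ noParallel e∈c₁ =
    let k , e≡orbit-k = orbit-complete e∈c₁ in subst (_∈ c₂) (sym e≡orbit-k) (orbit-⊆ k)
    where
    open DirCycle.BackwardOrbit cycle₁ v∈c₁

    entering : ∀ {e} → e ∈ c₁ → IsVertexOf D c₂ (tgt e) → e ∈ c₂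
    entering {e} e∈c₁ tgt∈V₂ with DirCycle.in-edge cycle₂ tgt∈V₂
    ... | e′ , e′∈c₂ , tgt≡ with e ≟ e′
    ...   | yes refl = e′∈c₂
    ...   | no e≢e′ = ⊥-elim (noParallel e e′ e∈c₁ e′∈c₂ (e≢e′ , src≡ , sym tgt≡))
      where
      src≡ : src e ≡ src e′
      src≡ = decidable-stable (src e ≟ src e′) λ src≢ → noPiercing e (c₂ , cycle₂ , e′ , e′∈c₂ , sym tgt≡ , src≢)

    orbit-⊆ : ∀ k → orbit k ∈ c₂
    orbit-⊆ zero = v∈c₂
    orbit-⊆ (suc k) = entering (orbit-∈ (suc k)) (subst (IsVertexOf D c₂)
      (sym (proj₂ (DirCycle.predecessor-spec cycle₁ (orbit-∈ k)))) (orbit k , orbit-⊆ k , inj₁ refl))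

  SameTargetPair : Subset nE → Set
  SameTargetPair h = ∃₂ λ e f → e ≢ f × tgt e ≡ tgt f × h ≡ ⁅ e ⁆ ∪ ⁅ f ⁆

  treeConflictFamily⇒cycle⊎pair : ∀ {h} → TreeConflictFamily D h → IsDirCycle D h ⊎ SameTargetPair h
  treeConflictFamily⇒cycle⊎pair (inj₁ cycle) = inj₁ cycle
  treeConflictFamily⇒cycle⊎pair (inj₂ (inj₁ (e , f , (e≢f , _ , tgt≡) , refl))) = inj₂ (e , f , e≢f , tgt≡ , refl)
  treeConflictFamily⇒cycle⊎pair (inj₂ (inj₂ (e , f , src≢ , tgt≡ , refl))) =
    inj₂ (e , f , (λ { refl → src≢ refl }) , tgt≡ , refl)

  sameTargetPair∈family : ∀ {e f} → e ≢ f → tgt e ≡ tgt f → TreeConflictFamily D (⁅ e ⁆ ∪ ⁅ f ⁆)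
  sameTargetPair∈family {e} {f} e≢f tgt≡ with src e ≟ src f
  ... | yes src≡ = inj₂ (inj₁ (e , f , (e≢f , src≡ , tgt≡) , refl))
  ... | no src≢ = inj₂ (inj₂ (e , f , src≢ , tgt≡ , refl))

  sameTargetPair-through : ∀ {h v} → SameTargetPair h → v ∈ h →
    ∃[ x ] (x ≢ v × tgt x ≡ tgt v × h ≡ ⁅ v ⁆ ∪ ⁅ x ⁆)
  sameTargetPair-through (e , f , e≢f , tgt≡ , refl) v∈ with x∈⁅y⁆∪⁅z⁆⁻ v∈
  ... | inj₁ refl = f , (λ f≡e → e≢f (sym f≡e)) , sym tgt≡ , refl
  ... | inj₂ refl = e , e≢f , tgt≡ , ∪-comm ⁅ e ⁆ ⁅ f ⁆

  MemberInside : Subset nE → Set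
  MemberInside σ = ∃[ t ] (TreeConflictFamily D t × t ⊆ σ)

  pair-pair-member : ∀ {v x y} → x ≢ y → x ≢ v → y ≢ v → tgt x ≡ tgt v → tgt y ≡ tgt v →
    MemberInside (((⁅ v ⁆ ∪ ⁅ x ⁆) ∪ (⁅ v ⁆ ∪ ⁅ y ⁆)) - v)
  pair-pair-member {v} {x} {y} x≢y x≢v y≢v tgt-x tgt-y =
    ⁅ x ⁆ ∪ ⁅ y ⁆ , sameTargetPair∈family x≢y (trans tgt-x (sym tgt-y)) ,
    ⁅x⁆∪⁅y⁆⊆p (x∈p∧x≢y⇒x∈p-y (x∈p∪q⁺ (inj₁ y∈p∪⁅y⁆)) x≢v) (x∈p∧x≢y⇒x∈p-y (x∈p∪q⁺ (inj₂ y∈p∪⁅y⁆)) y≢v)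

  pair-cycle-member : NoCyclePiercing D → ∀ {v x c} → x ≢ v → tgt x ≡ tgt v → IsDirCycle D c → v ∈ c →
    MemberInside (((⁅ v ⁆ ∪ ⁅ x ⁆) ∪ c) - v)
  pair-cycle-member noPiercing {v} {x} {c} x≢v tgt≡ cycle v∈c =
    (c - v) ∪ ⁅ x ⁆ , inj₁ (swap-parallel cycle v∈c x∉c src≡ tgt≡) , swapped⊆
    where
    src≡ : src x ≡ src v
    src≡ = decidable-stable (src x ≟ src v) λ src≢ → noPiercing x (c , cycle , v , v∈c , tgt≡ , src≢)
    x∉c : x ∉ c
    x∉c x∈c = proj₁ (proj₂ cycle) x v x∈c v∈c (x≢v , src≡ , tgt≡)
    swapped⊆ : (c - v) ∪ ⁅ x ⁆ ⊆ ((⁅ v ⁆ ∪ ⁅ x ⁆) ∪ c) - v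
    swapped⊆ z∈ with x∈p∪⁅y⁆⁻ z∈
    ... | inj₁ z∈c-v = let z∈c , z≢v = x∈p-y⁻ z∈c-v in x∈p∧x≢y⇒x∈p-y (x∈p∪q⁺ (inj₂ z∈c)) z≢v
    ... | inj₂ refl = x∈p∧x≢y⇒x∈p-y (x∈p∪q⁺ (inj₁ y∈p∪⁅y⁆)) x≢v

  cycle-cycle-member : NoCyclePiercing D → ∀ {v c₁ c₂} → IsDirCycle D c₁ → IsDirCycle D c₂ →
    Minimal (TreeConflictFamily D) c₂ → c₁ ≢ c₂ → v ∈ c₁ → v ∈ c₂ → MemberInside ((c₁ ∪ c₂) - v)
  cycle-cycle-member noPiercing {v} {c₁} {c₂} cycle₁ cycle₂ c₂-min c₁≢c₂ v∈c₁ v∈c₂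
    with any? (λ e → any? (λ e′ → e ∈? c₁ ×-dec e′ ∈? c₂ ×-dec parallel? e e′))
  ... | no ∄ = ⊥-elim (c₁≢c₂ (proj₂ c₂-min c₁ (inj₁ cycle₁)
    (cycle-⊆ noPiercing cycle₁ cycle₂ v∈c₁ v∈c₂ λ e e′ e∈ e′∈ e∥e′ → ∄ (e , e′ , e∈ , e′∈ , e∥e′))))
  ... | yes (e , e′ , e∈c₁ , e′∈c₂ , e∥e′@(e≢e′ , src≡ , tgt≡)) =
    ⁅ e ⁆ ∪ ⁅ e′ ⁆ , inj₂ (inj₁ (e , e′ , e∥e′ , refl)) ,
    ⁅x⁆∪⁅y⁆⊆p (x∈p∧x≢y⇒x∈p-y (x∈p∪q⁺ (inj₁ e∈c₁)) λ { refl → proj₁ (proj₂ cycle₂) v e′ v∈c₂ e′∈c₂ e∥e′ })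
              (x∈p∧x≢y⇒x∈p-y (x∈p∪q⁺ (inj₂ e′∈c₂)) λ { refl → proj₁ (proj₂ cycle₁) e v e∈c₁ v∈c₁ e∥e′ })

  treeConflict-allSimplicial : NoCyclePiercing D → AllSimplicial (TreeConflict D)
  treeConflict-allSimplicial noPiercing v h₁ h₂ h₁-min h₂-min h₁≢h₂ v∈h₁ v∈h₂ =
    let t , t∈F , t⊆ = member
        e , e-min , e⊆t = minimal-⊆ treeConflictFamily? t∈F
    in e , e-min , ⊆-trans e⊆t t⊆
    where
    member : MemberInside ((h₁ ∪ h₂) - v)
    member with treeConflictFamily⇒cycle⊎pair (proj₁ h₁-min) | treeConflictFamily⇒cycle⊎pair (proj₁ h₂-min)
    ... | inj₁ cycle₁ | inj₁ cycle₂ = cycle-cycle-member noPiercing cycle₁ cycle₂ h₂-min h₁≢h₂ v∈h₁ v∈h₂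
    ... | inj₁ cycle₁ | inj₂ pair₂ with sameTargetPair-through pair₂ v∈h₂
    ...   | x , x≢v , tgt≡ , refl = subst (λ σ → MemberInside (σ - v)) (∪-comm _ h₁)
                                       (pair-cycle-member noPiercing x≢v tgt≡ cycle₁ v∈h₁)
    member | inj₂ pair₁ | inj₁ cycle₂ with sameTargetPair-through pair₁ v∈h₁
    ... | x , x≢v , tgt≡ , refl = pair-cycle-member noPiercing x≢v tgt≡ cycle₂ v∈h₂
    member | inj₂ pair₁ | inj₂ pair₂ with sameTargetPair-through pair₁ v∈h₁ | sameTargetPair-through pair₂ v∈h₂
    ... | x , x≢v , tgt-x , refl | y , y≢v , tgt-y , refl =
      pair-pair-member (λ { refl → h₁≢h₂ refl }) x≢v y≢v tgt-x tgt-y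

  isDirForest⇔independent : ∀ σ → IsDirForest D σ ⇔ Independent (TreeConflict D) σ
  isDirForest⇔independent σ = mk⇔ forest⇒independent independent⇒forest
    where
    forest⇒independent : IsDirForest D σ → Independent (TreeConflict D) σ
    forest⇒independent (acyclic , in-forest) h (h∈F , _) h⊆σ with treeConflictFamily⇒cycle⊎pair h∈F
    ... | inj₁ cycle = acyclic h h⊆σ cycle
    ... | inj₂ (e , f , e≢f , tgt≡ , refl) = in-forest e f (h⊆σ (x∈p∪q⁺ (inj₁ (x∈⁅x⁆ e)))) (h⊆σ y∈p∪⁅y⁆) e≢f tgt≡

    independent⇒forest : Independent (TreeConflict D) σ → IsDirForest D σ
    independent⇒forest independent =
      (λ τ τ⊆σ cycle → no-member-inside (τ , inj₁ cycle , τ⊆σ)) ,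
      (λ e f e∈σ f∈σ e≢f tgt≡ → no-member-inside (_ , sameTargetPair∈family e≢f tgt≡ , ⁅x⁆∪⁅y⁆⊆p e∈σ f∈σ))
      where
      no-member-inside : ¬ MemberInside σ
      no-member-inside (t , t∈F , t⊆σ) =
        let h , h-min , h⊆t = minimal-⊆ treeConflictFamily? t∈F in independent h h-min (⊆-trans h⊆t t⊆σ)

theorem5p11 : (D : Multidigraph) → NoCyclePiercing D →
    WChordal (TreeConflict D) × Shellable (DT D)
theorem5p11 D noPiercing =
  allSimplicial⇒wChordal (treeConflict? D) simplicial ,
  shellable-cong (λ σ → ⇔.sym (isDirForest⇔independent D σ))
    (IndependenceComplex.independent-shellable {H = TreeConflict D} (treeConflict? D) simplicial)
  where
  simplicial : AllSimplicial (TreeConflict D)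
  simplicial = treeConflict-allSimplicial D noPiercing
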